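{- Let $G=(V,E)$ be a graph with $n=|V|$, let $a,b$ be positive integers, and let $L:V\to 2^{[a]}$. Let $C_a(G,L)$ be the set of all functions $c:V\to 2^{[a]}$ such that $c(u)\cap c(v)=\emptyset$ for every edge $uv\in E$ and $c(v)\subseteq L(v)$ for every $v\in V$. Define the polynomial over $\mathbb{F}_2$ in the variables $\{x_v\}_{v\in V}$ and $\{y_{v,j}\}_{v\in V,j\in[a]}$: $$p_G=\sum_{\substack{c\in C_a(G,L)\\ \sum_v |c(v)|=bn}}\ \prod_{v\in V} x_v^{|c(v)|}\prod_{j\in c(v)} y_{v,j}.$$ Then $G$ has an $L$-$(a\!:\!b)$-coloring if and only if $p_G$ contains a $b$-monomial.
   Context: $[a]=\{0,\dots,a-1\}$. An $L$-$(a\!:\!b)$-coloring assigns to each vertex $v$ exactly $b$ colors from $L(v)$ so that adjacent vertices receive disjoint color sets. An $r$-monomial is a monomial in which every variable has individual degree at most $r$; a polynomial "contains" a monomial if that monomial has nonzero coefficient. -}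

module Defs where

open import Data.Nat using (ℕ; zero; suc; _*_; _≤_; _≟_)
open import Data.Bool using (Bool; true; false; if_then_else_; _xor_) renaming (_≟_ to _≟ᵇ_)
open import Data.Fin using (Fin; zero; suc)
open import Data.Fin.Subset using (Subset; _⊆_; _∩_; ∣_∣) renaming (⊥ to ∅)
open import Data.Fin.Subset.Properties using (_⊆?_; _∈?_)
open import Data.Fin.Properties using (all?)
open import Data.Vec using (Vec; []; _∷_; tabulate)
import Data.Vec as Vec
open import Data.Vec.Properties using (≡-dec)
open import Data.List using (List; []; _∷_; map; concatMap; foldr)
open import Data.Product using (Σ; _×_; _,_; ∃)
open import Relation.Nullary using (Dec; yes; no; ¬_)
open import Relation.Nullary.Decidable using (⌊_⌋; _×-dec_; _→-dec_)
open import Relation.Binary.PropositionalEquality using (_≡_)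

record Graph (n : ℕ) : Set where
  field
    Adj    : Fin n → Fin n → Bool
    sym    : ∀ u v → Adj u v ≡ Adj v u
    irrefl : ∀ v → Adj v v ≡ false
open Graph public

-- Subsets of [a] = {0,…,a-1} are Subset a = Vec Bool a (Data.Fin.Subset).
-- Two subsets are disjoint iff their intersection is empty.
Disjoint : ∀ {a} → Subset a → Subset a → Set
Disjoint p q = p ∩ q ≡ ∅

disjoint? : ∀ {a} (p q : Subset a) → Dec (Disjoint p q)
disjoint? p q = ≡-dec _≟ᵇ_ (p ∩ q) ∅

IsLColoring : ∀ {n a} → Graph n → (Fin n → Subset a) → ℕ → (Fin n → Subset a) → Set
IsLColoring {n} G L b φ =
  (∀ v → φ v ⊆ L v) × (∀ v → ∣ φ v ∣ ≡ b) ×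
  (∀ u v → Adj G u v ≡ true → Disjoint (φ u) (φ v))

HasLColoring : ∀ {n a} → Graph n → (Fin n → Subset a) → ℕ → Set
HasLColoring {n} {a} G L b = Σ (Fin n → Subset a) (IsLColoring G L b)

InC : ∀ {n a} → Graph n → (Fin n → Subset a) → (Fin n → Subset a) → Set
InC G L c = (∀ u v → Adj G u v ≡ true → Disjoint (c u) (c v)) × (∀ v → c v ⊆ L v)

inC? : ∀ {n a} (G : Graph n) (L c : Fin n → Subset a) → Dec (InC G L c)
inC? G L c =
  all? (λ u → all? (λ v → (Adj G u v ≟ᵇ true) →-dec disjoint? (c u) (c v)))
  ×-dec all? (λ v → c v ⊆? L v)

record Monomial (n a : ℕ) : Set where
  constructor mono
  field
    xexp : Fin n → ℕ
    yexp : Fin n → Fin a → ℕ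
open Monomial public

_≈ᴹ_ : ∀ {n a} → Monomial n a → Monomial n a → Set
m ≈ᴹ m' = (∀ v → xexp m v ≡ xexp m' v) × (∀ v j → yexp m v j ≡ yexp m' v j)

_≈ᴹ?_ : ∀ {n a} (m m' : Monomial n a) → Dec (m ≈ᴹ m')
m ≈ᴹ? m' = all? (λ v → xexp m v ≟ xexp m' v)
           ×-dec all? (λ v → all? (λ j → yexp m v j ≟ yexp m' v j))

IsRMonomial : ∀ {n a} → ℕ → Monomial n a → Set
IsRMonomial r m = (∀ v → xexp m v ≤ r) × (∀ v j → yexp m v j ≤ r)

monoOf : ∀ {n a} → (Fin n → Subset a) → Monomial n a
monoOf c = mono (λ v → ∣ c v ∣) (λ v j → if ⌊ j ∈? c v ⌋ then 1 else 0)

sumV : ∀ {n} → (Fin n → ℕ) → ℕ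
sumV f = Vec.sum (tabulate f)

allSubsets : (a : ℕ) → List (Subset a)
allSubsets zero    = [] ∷ []
allSubsets (suc a) = concatMap (λ s → (true ∷ s) ∷ (false ∷ s) ∷ []) (allSubsets a)

consF : ∀ {n a} → Subset a → (Fin n → Subset a) → (Fin (suc n) → Subset a)
consF s f zero    = s
consF s f (suc i) = f i

allMaps : (n a : ℕ) → List (Fin n → Subset a)
allMaps zero    a = (λ ()) ∷ []
allMaps (suc n) a =
  concatMap (λ s → map (consF s) (allMaps n a)) (allSubsets a)

-- The polynomial p_G over F₂ (F₂ = Bool with xor as addition), represented
-- by its coefficient function: the coefficient of monomial m is
--   Σ_{c ∈ C_a(G,L), Σ_v |c(v)| = b n} [monoOf c = m]   (sum in F₂).
pG-coeff : ∀ {n a} → Graph n → (Fin n → Subset a) → ℕ → Monomial n a → Bool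
pG-coeff {n} {a} G L b m =
  foldr _xor_ false
    (map (λ c → ⌊ inC? G L c ×-dec (sumV (λ v → ∣ c v ∣) ≟ b * n)
                   ×-dec (monoOf c ≈ᴹ? m) ⌋)
         (allMaps n a))

Contains : ∀ {n a} → Graph n → (Fin n → Subset a) → ℕ → Monomial n a → Set
Contains G L b m = pG-coeff G L b m ≡ true

module Submission where

-- Over F₂ the coefficient of a monomial m in p_G is the parity of the number of
-- colourings c ∈ C_a(G,L) with Σ_v |c(v)| = bn and monoOf c = m.  The y-exponents
-- of monoOf c record every set c(v), so that number is at most one: for an
-- L-(a:b)-colouring φ the monomial of φ is a b-monomial occurring exactly once.
-- Conversely a contained b-monomial comes from some such c with |c(v)| ≤ b for all
-- v, and Σ_v |c(v)| = bn forces |c(v)| = b, so c is an L-(a:b)-colouring.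

open import Defs hiding (sym)
open import Data.Nat using (ℕ; zero; suc; _+_; _*_; _≤_; _≟_; z≤n)
open import Data.Nat.Properties
  using (≤-refl; ≤-trans; ≤-antisym; ≤-reflexive; +-mono-≤; +-monoʳ-≤; +-cancelʳ-≤; +-cancelˡ-≡;
         *-suc; *-zeroʳ)
open import Data.Bool using (Bool; true; false; _xor_; if_then_else_)
open import Data.Bool.Properties using (xor-assoc; xor-identityʳ; ¬-not; T-≡)
open import Data.Fin using (Fin; zero; suc)
open import Data.Fin.Subset using (Subset; _⊆_; ∣_∣)
open import Data.Fin.Subset.Properties using (_∈?_; ⊆-antisym)
open import Data.Vec using ([]; _∷_)
import Data.Vec as Vec
open import Data.Vec.Properties using (∷-injectiveʳ; tabulate-cong)
open import Data.List using (List; []; _∷_; map; foldr; _++_; concatMap)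
open import Data.List.Properties using (map-++; map-∘; map-cong)
open import Data.Product using (Σ; ∃; _×_; _,_; proj₁; proj₂)
open import Function using (_∘_)
open import Function.Bundles using (_⇔_; mk⇔; Equivalence)
open import Relation.Nullary using (Dec; yes; no; ¬_; contradiction)
open import Relation.Nullary.Decidable using (⌊_⌋; _×-dec_; toWitness; fromWitness)
open import Relation.Binary.PropositionalEquality
open ≡-Reasoning

open Equivalence using (to; from)

parity : List Bool → Bool
parity = foldr _xor_ false

parity-++ : (xs ys : List Bool) → parity (xs ++ ys) ≡ parity xs xor parity ys
parity-++ []       ys = refl
parity-++ (x ∷ xs) ys = begin
  x xor parity (xs ++ ys)          ≡⟨ cong (x xor_) (parity-++ xs ys) ⟩
  x xor (parity xs xor parity ys)  ≡⟨ sym (xor-assoc x (parity xs) (parity ys)) ⟩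
  (x xor parity xs) xor parity ys  ∎

parity-concatMap : ∀ {A B : Set} (h : B → Bool) (f : A → List B) (xs : List A) →
  parity (map h (concatMap f xs)) ≡ parity (map (parity ∘ map h ∘ f) xs)
parity-concatMap h f []       = refl
parity-concatMap h f (x ∷ xs) = begin
  parity (map h (f x ++ concatMap f xs))
    ≡⟨ cong parity (map-++ h (f x) (concatMap f xs)) ⟩
  parity (map h (f x) ++ map h (concatMap f xs))
    ≡⟨ parity-++ (map h (f x)) (map h (concatMap f xs)) ⟩
  parity (map h (f x)) xor parity (map h (concatMap f xs))
    ≡⟨ cong (parity (map h (f x)) xor_) (parity-concatMap h f xs) ⟩
  parity (map (parity ∘ map h ∘ f) (x ∷ xs)) ∎

parity-true⇒∃ : ∀ {A : Set} (h : A → Bool) (xs : List A) →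
  parity (map h xs) ≡ true → ∃ λ x → h x ≡ true
parity-true⇒∃ h []       ()
parity-true⇒∃ h (x ∷ xs) odd with h x in hx
... | true  = x , hx
... | false = parity-true⇒∃ h xs odd

IsIndicator : ∀ {A : Set} → (A → Bool) → (A → Set) → Set
IsIndicator h P = ∀ x → h x ≡ true ⇔ P x

indicator-false : ∀ {A : Set} {h : A → Bool} {P : A → Set} →
  IsIndicator h P → ∀ {x} → ¬ P x → h x ≡ false
indicator-false ind {x} ¬px = ¬-not (¬px ∘ to (ind x))

parity-allSubsets-suc : ∀ a (h : Subset (suc a) → Bool) →
  parity (map h (allSubsets (suc a)))
    ≡ parity (map (λ s → h (true ∷ s) xor h (false ∷ s)) (allSubsets a))
parity-allSubsets-suc a h =
  trans (parity-concatMap h (λ s → (true ∷ s) ∷ (false ∷ s) ∷ []) (allSubsets a))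
        (cong parity (map-cong (λ s → cong (h (true ∷ s) xor_) (xor-identityʳ _)) (allSubsets a)))

indicator-pair : ∀ {a} {h : Subset (suc a) → Bool} x (t : Subset a) →
  IsIndicator h (_≡ x ∷ t) → h (true ∷ t) xor h (false ∷ t) ≡ true
indicator-pair true  t ind = cong₂ _xor_ (from (ind _) refl) (indicator-false ind λ ())
indicator-pair false t ind = cong₂ _xor_ (indicator-false ind λ ()) (from (ind _) refl)

indicator-pairs : ∀ {a} {h : Subset (suc a) → Bool} x (t : Subset a) →
  IsIndicator h (_≡ x ∷ t) → IsIndicator (λ s → h (true ∷ s) xor h (false ∷ s)) (_≡ t)
indicator-pairs {h = h} x t ind s = mk⇔ hit⇒≡ λ { refl → indicator-pair x t ind }
  where
  hit⇒≡ : h (true ∷ s) xor h (false ∷ s) ≡ true → s ≡ t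
  hit⇒≡ odd with h (true ∷ s) in h₁
  ... | true  = ∷-injectiveʳ (to (ind _) h₁)
  ... | false = ∷-injectiveʳ (to (ind _) odd)

parity-allSubsets-indicator : ∀ a {h : Subset a → Bool} (t : Subset a) →
  IsIndicator h (_≡ t) → parity (map h (allSubsets a)) ≡ true
parity-allSubsets-indicator zero    []      ind = trans (xor-identityʳ _) (from (ind []) refl)
parity-allSubsets-indicator (suc a) (x ∷ t) ind =
  trans (parity-allSubsets-suc a _) (parity-allSubsets-indicator a t (indicator-pairs x t ind))

parity-allMaps-suc : ∀ n a (h : (Fin (suc n) → Subset a) → Bool) →
  parity (map h (allMaps (suc n) a))
    ≡ parity (map (λ s → parity (map (h ∘ consF s) (allMaps n a))) (allSubsets a))
parity-allMaps-suc n a h =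
  trans (parity-concatMap h (λ s → map (consF s) (allMaps n a)) (allSubsets a))
        (cong parity (map-cong (λ s → cong parity (sym (map-∘ (allMaps n a)))) (allSubsets a)))

parity-allMaps-indicator : ∀ n a {h : (Fin n → Subset a) → Bool} (φ : Fin n → Subset a) →
  IsIndicator h (_≗ φ) → parity (map h (allMaps n a)) ≡ true
parity-allMaps-indicator zero    a φ ind = trans (xor-identityʳ _) (from (ind _) λ ())
parity-allMaps-indicator (suc n) a {h} φ ind =
  trans (parity-allMaps-suc n a h) (parity-allSubsets-indicator a (φ zero) head-indicator)
  where
  tail-indicator : IsIndicator (h ∘ consF (φ zero)) (_≗ φ ∘ suc)
  tail-indicator c = mk⇔ (λ hit v → to (ind _) hit (suc v))
                         (λ c≗ → from (ind _) λ { zero → refl ; (suc v) → c≗ v })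
  head-indicator : IsIndicator (λ s → parity (map (h ∘ consF s) (allMaps n a))) (_≡ φ zero)
  head-indicator s = mk⇔
    (λ odd → let (c , hit) = parity-true⇒∃ (h ∘ consF s) (allMaps n a) odd in to (ind _) hit zero)
    (λ { refl → parity-allMaps-indicator n a (φ ∘ suc) tail-indicator })

sumV-cong : ∀ {n} {f g : Fin n → ℕ} → f ≗ g → sumV f ≡ sumV g
sumV-cong f≗g = cong Vec.sum (tabulate-cong f≗g)

sumV-const : ∀ {n} b → sumV {n} (λ _ → b) ≡ b * n
sumV-const {zero}  b = sym (*-zeroʳ b)
sumV-const {suc n} b = trans (cong (b +_) (sumV-const b)) (sym (*-suc b n))

sumV-mono-≤ : ∀ {n} {f g : Fin n → ℕ} → (∀ v → f v ≤ g v) → sumV f ≤ sumV g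
sumV-mono-≤ {zero}  f≤g = ≤-refl
sumV-mono-≤ {suc n} f≤g = +-mono-≤ (f≤g zero) (sumV-mono-≤ (f≤g ∘ suc))

+-mono-≤-equality : ∀ {m n o p} → m ≤ n → o ≤ p → m + o ≡ n + p → m ≡ n × o ≡ p
+-mono-≤-equality {m} {n} {o} {p} m≤n o≤p eq =
  m≡n , +-cancelˡ-≡ n o p (subst (λ k → k + o ≡ n + p) m≡n eq)
  where
  m≡n : m ≡ n
  m≡n = ≤-antisym m≤n (+-cancelʳ-≤ o n m (≤-trans (+-monoʳ-≤ n o≤p) (≤-reflexive (sym eq))))

sumV-mono-≤-equality : ∀ {n} {f g : Fin n → ℕ} → (∀ v → f v ≤ g v) → sumV f ≡ sumV g → f ≗ g
sumV-mono-≤-equality {zero}  _   _  ()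
sumV-mono-≤-equality {suc n} f≤g eq with +-mono-≤-equality (f≤g zero) (sumV-mono-≤ (f≤g ∘ suc)) eq
... | head≡ , tail≡ = λ { zero → head≡ ; (suc v) → sumV-mono-≤-equality (f≤g ∘ suc) tail≡ v }

χ : ∀ {a} → Subset a → Fin a → ℕ
χ p j = if ⌊ j ∈? p ⌋ then 1 else 0

χ-≤1 : ∀ {a} (p : Subset a) j → χ p j ≤ 1
χ-≤1 p j with j ∈? p
... | yes _ = ≤-refl
... | no  _ = z≤n

χ-⊆ : ∀ {a} {p q : Subset a} → (∀ j → χ p j ≡ χ q j) → p ⊆ q
χ-⊆ {p = p} {q} χ≡ {j} j∈p with j ∈? p | j ∈? q | χ≡ j
... | yes _   | yes j∈q | _  = j∈q
... | yes _   | no  _   | ()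
... | no j∉p  | _       | _  = contradiction j∈p j∉p

χ-injective : ∀ {a} {p q : Subset a} → (∀ j → χ p j ≡ χ q j) → p ≡ q
χ-injective χ≡ = ⊆-antisym (χ-⊆ χ≡) (χ-⊆ (sym ∘ χ≡))

monoOf-injective : ∀ {n a} {c c′ : Fin n → Subset a} → monoOf c ≈ᴹ monoOf c′ → c ≗ c′
monoOf-injective (_ , y≡) v = χ-injective (y≡ v)

monoOf-isRMonomial : ∀ {n a b} {φ : Fin n → Subset a} → 1 ≤ b →
  (∀ v → ∣ φ v ∣ ≡ b) → IsRMonomial b (monoOf φ)
monoOf-isRMonomial {φ = φ} 1≤b card = (≤-reflexive ∘ card) , λ v j → ≤-trans (χ-≤1 (φ v) j) 1≤b

module _ {n a} (G : Graph n) (L : Fin n → Subset a) (b : ℕ) where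

  -- The summands of p_G: pG-coeff G L b m is definitionally the parity of ⌊ term? m c ⌋ over allMaps.
  Term : Monomial n a → (Fin n → Subset a) → Set
  Term m c = InC G L c × sumV (λ v → ∣ c v ∣) ≡ b * n × monoOf c ≈ᴹ m

  term? : ∀ m c → Dec (Term m c)
  term? m c = inC? G L c ×-dec (sumV (λ v → ∣ c v ∣) ≟ b * n) ×-dec (monoOf c ≈ᴹ? m)

  hit⇒Term : ∀ {m c} → ⌊ term? m c ⌋ ≡ true → Term m c
  hit⇒Term {m} {c} hit = toWitness {a? = term? m c} (from T-≡ hit)

  Term⇒hit : ∀ {m c} → Term m c → ⌊ term? m c ⌋ ≡ true
  Term⇒hit {m} {c} term = to T-≡ (fromWitness {a? = term? m c} term)

  Contains⇒Term : ∀ {m} → Contains G L b m → ∃ (Term m)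
  Contains⇒Term odd =
    let (c , hit) = parity-true⇒∃ _ (allMaps n a) odd
    in c , hit⇒Term hit

  Term⇒coloring : ∀ {m c} → IsRMonomial b m → Term m c → IsLColoring G L b c
  Term⇒coloring {c = c} (x≤b , _) ((disjoint , ⊆L) , sum≡ , x≡ , _) = ⊆L , card , disjoint
    where
    card : ∀ v → ∣ c v ∣ ≡ b
    card = sumV-mono-≤-equality (λ v → subst (_≤ b) (sym (x≡ v)) (x≤b v))
                                (trans sum≡ (sym (sumV-const b)))

  coloring⇒Term : ∀ {φ} → IsLColoring G L b φ → Term (monoOf φ) φ
  coloring⇒Term (⊆L , card , disjoint) =
    (disjoint , ⊆L) , trans (sumV-cong card) (sumV-const b) , (λ _ → refl) , (λ _ _ → refl)

  Term-resp-≗ : ∀ {m c c′} → c ≗ c′ → Term m c′ → Term m c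
  Term-resp-≗ c≗c′ ((disjoint , ⊆L) , sum≡ , x≡ , y≡) =
    ( (λ u v uv → subst₂ Disjoint (sym (c≗c′ u)) (sym (c≗c′ v)) (disjoint u v uv))
    , (λ v → subst (_⊆ L v) (sym (c≗c′ v)) (⊆L v)) )
    , trans (sumV-cong (cong ∣_∣ ∘ c≗c′)) sum≡
    , (λ v → trans (cong ∣_∣ (c≗c′ v)) (x≡ v))
    , (λ v j → trans (cong (λ p → χ p j) (c≗c′ v)) (y≡ v j))

  coloring-contains-monoOf : ∀ {φ} → IsLColoring G L b φ → Contains G L b (monoOf φ)
  coloring-contains-monoOf {φ} col = parity-allMaps-indicator n a φ λ c → mk⇔
    (λ hit → monoOf-injective (proj₂ (proj₂ (hit⇒Term {monoOf φ} {c} hit))))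
    (λ c≗φ → Term⇒hit (Term-resp-≗ c≗φ (coloring⇒Term col)))

proposition17 : ∀ {n a b : ℕ} → 1 ≤ a → 1 ≤ b →
    (G : Graph n) (L : Fin n → Subset a) →
    HasLColoring G L b ⇔
      Σ (Monomial n a) (λ m → IsRMonomial b m × Contains G L b m)
proposition17 {b = b} _ 1≤b G L = mk⇔
  (λ (φ , col@(_ , card , _)) →
     monoOf φ , monoOf-isRMonomial 1≤b card , coloring-contains-monoOf G L b col)
  (λ (m , b-mono , contains) →
     let (c , term) = Contains⇒Term G L b contains
     in c , Term⇒coloring G L b b-mono term)
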